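{- For every fixed $s\ge2$, letting $k=2^{s-1}+1$, we have $N^s_k(m)=O\bigl(m(\log m)^{s-2}\bigr)$, where the implied constant may depend on $s$.
   Context: An $\mathrm{ADS}^s_k(m)$-sequence is a sequence that is a concatenation of $m$ blocks, each block containing only distinct symbols, in which every symbol appears at least $k$ times, and which contains no (not necessarily contiguous) alternation $a\,b\,a\,b\ldots$ of length $s+2$ with $a\ne b$ (adjacent equal symbols at block interfaces are allowed). $N^s_k(m)$ is the maximum number of distinct symbols in an $\mathrm{ADS}^s_k(m)$-sequence. -}

module Defs where

open import Data.Nat using (ℕ; zero; suc; _+_; _*_; _^_; _≤_; _∸_)
open import Data.Nat.Properties using (_≟_)
open import Data.List using (List; []; _∷_; length; concat; filter; deduplicate)
open import Data.List.Relation.Unary.All using (All)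
open import Data.List.Relation.Unary.Unique.Propositional using (Unique)
open import Data.List.Membership.Propositional using (_∈_)
open import Data.List.Relation.Binary.Sublist.Propositional using (_⊆_)
open import Data.Product using (_×_)
open import Relation.Binary.PropositionalEquality using (_≡_)
open import Relation.Nullary using (¬_)

-- Symbols are natural numbers; a sequence is given as its list of blocks.
Block : Set
Block = List ℕ

flatten : List Block → List ℕ
flatten = concat

occ : ℕ → List ℕ → ℕ
occ a xs = length (filter (_≟ a) xs)

alt : ℕ → ℕ → ℕ → List ℕ
alt a b zero    = []
alt a b (suc n) = a ∷ alt b a n

distinct : List ℕ → ℕ
distinct xs = length (deduplicate _≟_ xs)

record IsADS (s k m : ℕ) (bs : List Block) : Set where
  field
    nblocks   : length bs ≡ m
    blocksDistinct : All Unique bs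
    frequent  : ∀ a → a ∈ flatten bs → k ≤ occ a (flatten bs)
    noAlt     : ∀ a b → ¬ (a ≡ b) → ¬ (alt a b (s + 2) ⊆ flatten bs)

module Submission where

-- A list S of distinct symbols is (n,k)-good in a sequence w if every symbol of S
-- occurs at least k times in w and no two distinct symbols of S form an
-- alternation of length n in w.  Writing s = t + 2, the key estimate
-- `good-bound` says: if w consists of at most 2^j blocks and S is
-- (s+2, 2^(s-1)+1)-good in w, then |S| ≤ 2^j · j^t.
--
--  * s = 2 (`good-bound-base`): restricted to S, w is abab-free, so its length is
--    at most 2|S| plus its number of adjacent repetitions (`abab-free-length`),
--    and only block boundaries can carry repetitions; since each symbol occurs
--    three times, |S| ≤ #blocks.
--  * s ↦ s+1 (`halving`): cut the blocks into two halves u, v.  Symbols living in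
--    one half only are good of the same order there.  A symbol living in both
--    halves occurs more than 2^(s-1) times in one of them, and there each of its
--    alternations extends by one letter taken from the other half, so it is
--    good of order s - 1.  Hence f(t+1, j+1) ≤ 2 f(t+1, j) + 2 f(t, j).
--
-- The corollary takes j = ⌊log₂ m⌋ + 1 and bounds 2^j j^t ≤ 2^(t+1) m ⌊log₂ m⌋^t.

open import Defs
open import Function using (_∘_)
open import Data.Nat using (ℕ; zero; suc; _+_; _*_; _^_; _≤_; _<_; _∸_; z≤n; s≤s; _≤?_; ⌊_/2⌋)
open import Data.Nat.Properties
open import Data.Nat.Induction using (<-rec)
open import Data.Nat.Logarithm using (⌊log₂_⌋; ⌊log₂⌋-mono-≤; ⌊log₂[2^n]⌋≡n; ⌊log₂⌊n/2⌋⌋≡⌊log₂n⌋∸1)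
open import Data.Nat.Solver using (module +-*-Solver)
open import Data.List using (List; []; _∷_; _++_; [_]; length; concat; filter; map; take; drop; deduplicate)
open import Data.List.Properties
  using (length-++; length-map; length-filter; filter-++; filter-accept; filter-reject; filter-none; filter-notAll;
         concat-++; take++drop≡id; length-take; length-drop)
open import Data.List.Relation.Unary.All as All using (All; []; _∷_)
open import Data.List.Relation.Unary.All.Properties using (map⁺; take⁺; drop⁺)
open import Data.List.Relation.Unary.Any as Any using (here; there)
open import Data.List.Relation.Unary.AllPairs using ([]; _∷_)
open import Data.List.Relation.Unary.Unique.Propositional using (Unique)
open import Data.List.Relation.Unary.Unique.Propositional.Properties using (filter⁺)
open import Data.List.Relation.Unary.Unique.DecPropositional.Properties _≟_ using (deduplicate-!)
open import Data.List.Membership.Propositional using (_∈_; _∉_)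
open import Data.List.Membership.Propositional.Properties using (∈-filter⁺; ∈-filter⁻; ∈-deduplicate⁻)
open import Data.List.Membership.DecPropositional _≟_ using (_∈?_)
open import Data.List.Relation.Binary.Equality.Propositional using (≋⇒≡)
open import Data.List.Relation.Binary.Sublist.Propositional using (_⊆_; _∷_; _∷ʳ_; ⊆-refl; ⊆-trans; to∈; from∈)
open import Data.List.Relation.Binary.Sublist.Propositional.Properties
  using (++⁺; ++⁺ˡ; ++⁺ʳ; ∷ˡ⁻; filter-⊆; length-mono-≤; to-≋)
  renaming (filter⁺ to ⊆-filter⁺)
open import Data.Product using (Σ; _×_; _,_; proj₁; proj₂)
open import Data.Empty using (⊥-elim)
open import Relation.Nullary using (¬_; yes; no; ¬?)
open import Relation.Unary using (Decidable)
open import Relation.Binary.PropositionalEquality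
  using (_≡_; _≢_; refl; sym; trans; cong; subst; subst₂; cong₂; module ≡-Reasoning)

occ-++ : ∀ a xs ys → occ a (xs ++ ys) ≡ occ a xs + occ a ys
occ-++ a xs ys = trans (cong length (filter-++ (_≟ a) xs ys)) (length-++ (filter (_≟ a) xs))

occ-hit : ∀ {a x} xs → x ≡ a → occ a (x ∷ xs) ≡ suc (occ a xs)
occ-hit {a} xs x≡a = cong length (filter-accept (_≟ a) x≡a)

occ-miss : ∀ {a x} xs → x ≢ a → occ a (x ∷ xs) ≡ occ a xs
occ-miss {a} xs x≢a = cong length (filter-reject (_≟ a) x≢a)

occ-pos⇒∈ : ∀ {a} xs → 0 < occ a xs → a ∈ xs
occ-pos⇒∈ {a} (x ∷ xs) pos with x ≟ a
... | yes refl = here refl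
... | no  x≢a  = there (occ-pos⇒∈ xs (subst (0 <_) (occ-miss xs x≢a) pos))

occ-absent : ∀ {a} xs → All (a ≢_) xs → occ a xs ≡ 0
occ-absent {a} xs a∉xs =
  cong length (filter-none (_≟ a) (All.map (λ a≢x x≡a → a≢x (sym x≡a)) a∉xs))

occ-unique : ∀ a xs → Unique xs → occ a xs ≤ 1
occ-unique a []       []           = z≤n
occ-unique a (x ∷ xs) (x∉xs ∷ u) with x ≟ a
... | yes refl = subst (_≤ 1) (sym (occ-hit xs refl)) (s≤s (≤-reflexive (occ-absent xs x∉xs)))
... | no  x≢a  = subst (_≤ 1) (sym (occ-miss xs x≢a)) (occ-unique a xs u)

occ-concat : ∀ a bs → All Unique bs → occ a (concat bs) ≤ length bs
occ-concat a []       []       = z≤n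
occ-concat a (b ∷ bs) (u ∷ us) =
  subst (_≤ suc (length bs)) (sym (occ-++ a b (concat bs)))
        (+-mono-≤ (occ-unique a b u) (occ-concat a bs us))

occ-filter : ∀ {P : ℕ → Set} (P? : Decidable P) {a} w → P a → occ a (filter P? w) ≡ occ a w
occ-filter P?     []      pa = refl
occ-filter P? {a} (x ∷ w) pa with P? x | x ≟ a
... | yes _   | yes x≡a = trans (occ-hit _ x≡a) (trans (cong suc (occ-filter P? w pa)) (sym (occ-hit w x≡a)))
... | yes _   | no  x≢a = trans (occ-miss _ x≢a) (trans (occ-filter P? w pa) (sym (occ-miss w x≢a)))
... | no  ¬px | yes refl = ⊥-elim (¬px pa)
... | no  _   | no  x≢a = trans (occ-filter P? w pa) (sym (occ-miss w x≢a))

length-split : ∀ {P : ℕ → Set} (P? : Decidable P) xs →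
  length xs ≡ length (filter P? xs) + length (filter (¬? ∘ P?) xs)
length-split P? []       = refl
length-split P? (x ∷ xs) with P? x
... | yes _ = cong suc (length-split P? xs)
... | no  _ = trans (cong suc (length-split P? xs)) (sym (+-suc _ _))

remove : ℕ → List ℕ → List ℕ
remove v = filter (λ z → ¬? (z ≟ v))

remove-shrinks : ∀ {v} xs → v ∈ xs → suc (length (remove v xs)) ≤ length xs
remove-shrinks {v} xs v∈xs =
  filter-notAll (λ z → ¬? (z ≟ v)) xs (Any.map (λ v≡z z≢v → z≢v (sym v≡z)) v∈xs)

remove-keeps : ∀ {v z} xs → z ∈ xs → z ≢ v → z ∈ remove v xs
remove-keeps {v} xs = ∈-filter⁺ (λ z → ¬? (z ≟ v))

occurrence-mass : ∀ k S w → Unique S → (∀ {a} → a ∈ S → k ≤ occ a w) → k * length S ≤ length w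
occurrence-mass k []      w _            _    = subst (_≤ length w) (sym (*-zeroʳ k)) z≤n
occurrence-mass k (a ∷ S) w (a∉S ∷ uniq) freq = begin
  k * suc (length S)             ≡⟨ *-suc k (length S) ⟩
  k + k * length S               ≤⟨ +-mono-≤ (freq (here refl)) (occurrence-mass k S (remove a w) uniq freq′) ⟩
  occ a w + length (remove a w)  ≡⟨ length-split (_≟ a) w ⟨
  length w                       ∎
  where
  open ≤-Reasoning
  freq′ : ∀ {b} → b ∈ S → k ≤ occ b (remove a w)
  freq′ b∈S = subst (k ≤_) (sym (occ-filter _ w (λ b≡a → All.lookup a∉S b∈S (sym b≡a))))
                    (freq (there b∈S))

alt-last : ℕ → ℕ → ℕ → ℕ
alt-last a b zero    = a
alt-last a b (suc n) = alt-last b a n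

alt-snoc : ∀ a b n → alt a b (suc n) ≡ alt a b n ++ [ alt-last a b n ]
alt-snoc a b zero    = refl
alt-snoc a b (suc n) = cong (a ∷_) (alt-snoc b a n)

alt-last-elim : ∀ {P : ℕ → Set} a b n → P a → P b → P (alt-last a b n)
alt-last-elim a b zero    pa pb = pa
alt-last-elim a b (suc n) pa pb = alt-last-elim b a n pb pa

starts-with : ℕ → List ℕ → ℕ
starts-with x []      = 0
starts-with x (y ∷ _) = occ x [ y ]

starts-with≤1 : ∀ x w → starts-with x w ≤ 1
starts-with≤1 x []      = z≤n
starts-with≤1 x (y ∷ _) = length-filter (_≟ x) [ y ]

repeats : List ℕ → ℕ
repeats []      = 0
repeats (x ∷ w) = starts-with x w + repeats w

repeats-cons : ∀ x w → repeats w ≤ repeats (x ∷ w)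
repeats-cons x w = m≤n+m (repeats w) _

repeats-dup : ∀ x w → repeats (x ∷ x ∷ w) ≡ suc (repeats (x ∷ w))
repeats-dup x w = cong (_+ repeats (x ∷ w)) (occ-hit {x} [] refl)

repeats-++ : ∀ xs ys → repeats (xs ++ ys) ≤ repeats xs + suc (repeats ys)
repeats-++ []           ys = n≤1+n _
repeats-++ (x ∷ [])     ys = +-monoˡ-≤ (repeats ys) (starts-with≤1 x ys)
repeats-++ (x ∷ y ∷ xs) ys =
  subst (repeats (x ∷ y ∷ xs ++ ys) ≤_) (sym (+-assoc (occ x [ y ]) (repeats (y ∷ xs)) _))
        (+-monoʳ-≤ (occ x [ y ]) (repeats-++ (y ∷ xs) ys))

repeats-unique : ∀ xs → Unique xs → repeats xs ≡ 0
repeats-unique []          _                  = refl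
repeats-unique (x ∷ [])    _                  = refl
repeats-unique (x ∷ y ∷ r) ((x≢y ∷ _) ∷ uniq) =
  cong₂ _+_ (occ-miss [] (x≢y ∘ sym)) (repeats-unique (y ∷ r) uniq)

repeats-concat : ∀ bs → All Unique bs → repeats (concat bs) ≤ length bs
repeats-concat []       []       = z≤n
repeats-concat (b ∷ bs) (u ∷ us) = ≤-trans (repeats-++ b (concat bs))
  (subst (λ r → r + suc (repeats (concat bs)) ≤ suc (length bs)) (sym (repeats-unique b u))
         (s≤s (repeats-concat bs us)))

AbabFree : List ℕ → Set
AbabFree w = ∀ a b → a ≢ b → ¬ (alt a b 4 ⊆ w)

abab-free-⊆ : ∀ {xs ys} → xs ⊆ ys → AbabFree ys → AbabFree xs
abab-free-⊆ xs⊆ys free a b a≢b p = free a b a≢b (⊆-trans p xs⊆ys)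

drop-second : ∀ z x w → AbabFree (z ∷ x ∷ w) → AbabFree (z ∷ w)
drop-second z x w = abab-free-⊆ (refl ∷ (x ∷ʳ ⊆-refl))

dup-head : ∀ {y r} → AbabFree (y ∷ r) → AbabFree (y ∷ y ∷ r)
dup-head free a b a≢b (refl ∷ (refl ∷ _)) = a≢b refl
dup-head free a b a≢b (refl ∷ (_ ∷ʳ p))   = free a b a≢b (refl ∷ p)
dup-head free a b a≢b (_ ∷ʳ p)            = free a b a≢b p

present : List ℕ → List ℕ → ℕ
present S w = length (filter (_∈? w) S)

present-⊆ : ∀ S x w → filter (_∈? w) S ⊆ filter (_∈? (x ∷ w)) S
present-⊆ S x w = ⊆-filter⁺ (_∈? w) (_∈? (x ∷ w)) (λ { refl → there }) (⊆-refl {x = S})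

present-mono : ∀ S x w → present S w ≤ present S (x ∷ w)
present-mono S x w = length-mono-≤ (present-⊆ S x w)

present-fresh : ∀ {x w} S → x ∉ w → x ∈ S → suc (present S w) ≤ present S (x ∷ w)
present-fresh {x} {w} S x∉w x∈S = ≤∧≢⇒< (present-mono S x w) differ
  where
  differ : present S w ≢ present S (x ∷ w)
  differ same-count = x∉w (proj₂ (∈-filter⁻ (_∈? w) {xs = S} (subst (x ∈_) (sym same-list) x-counted)))
    where
    same-list : filter (_∈? w) S ≡ filter (_∈? (x ∷ w)) S
    same-list = ≋⇒≡ (to-≋ same-count (present-⊆ S x w))
    x-counted : x ∈ filter (_∈? (x ∷ w)) S
    x-counted = ∈-filter⁺ (_∈? (x ∷ w)) x∈S (here refl)

-- Reading w from right to left, keep a list of the symbols that may still be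
-- prepended without creating an alternation abab.  The budget inequality
-- |w| + #alive ≤ 2·present + repeats is preserved by every prepended letter.
record Alive (S w : List ℕ) : Set where
  field
    alive    : List ℕ
    budget   : length w + length alive ≤ present S w + present S w + repeats w
    complete : ∀ {z} → z ∈ w → AbabFree (z ∷ w) → z ∈ alive

-- A new symbol costs one letter and becomes alive.
fresh-step : ∀ {S x w} → x ∉ w → x ∈ S → Alive S w → Alive S (x ∷ w)
fresh-step {S} {x} {w} x∉w x∈S A = record
  { alive = x ∷ alive ; budget = budget′ ; complete = complete′ }
  where
  open Alive A
  p p′ r : ℕ
  p = present S w
  p′ = present S (x ∷ w)
  r = repeats w
  budget′ : length (x ∷ w) + length (x ∷ alive) ≤ p′ + p′ + repeats (x ∷ w)
  budget′ = begin
    suc (length w) + suc (length alive)  ≡⟨ cong suc (+-suc (length w) (length alive)) ⟩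
    suc (suc (length w + length alive))  ≤⟨ s≤s (s≤s budget) ⟩
    suc (suc (p + p + r))                ≡⟨ cong (λ q → suc (q + r)) (+-suc p p) ⟨
    suc p + suc p + r                    ≤⟨ +-mono-≤ (+-mono-≤ new new) (repeats-cons x w) ⟩
    p′ + p′ + repeats (x ∷ w)            ∎
    where
    open ≤-Reasoning
    new : suc p ≤ p′
    new = present-fresh S x∉w x∈S
  complete′ : ∀ {z} → z ∈ x ∷ w → AbabFree (z ∷ x ∷ w) → z ∈ x ∷ alive
  complete′ (here refl) _    = here refl
  complete′ (there z∈w) free = there (complete z∈w (drop-second _ x w free))

-- A repeated letter is paid for by the repetition counter.
repeat-step : ∀ {S x w} → Alive S (x ∷ w) → Alive S (x ∷ x ∷ w)
repeat-step {S} {x} {w} A = record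
  { alive = alive ; budget = budget′ ; complete = complete′ }
  where
  open Alive A
  p p′ : ℕ
  p = present S (x ∷ w)
  p′ = present S (x ∷ x ∷ w)
  budget′ : length (x ∷ x ∷ w) + length alive ≤ p′ + p′ + repeats (x ∷ x ∷ w)
  budget′ = begin
    suc (length (x ∷ w) + length alive)  ≤⟨ s≤s budget ⟩
    suc (p + p + repeats (x ∷ w))        ≡⟨ +-suc (p + p) (repeats (x ∷ w)) ⟨
    p + p + suc (repeats (x ∷ w))        ≤⟨ +-mono-≤ (+-mono-≤ mono mono) (≤-reflexive (sym (repeats-dup x w))) ⟩
    p′ + p′ + repeats (x ∷ x ∷ w)        ∎
    where
    open ≤-Reasoning
    mono : p ≤ p′
    mono = present-mono S x (x ∷ w)
  complete′ : ∀ {z} → z ∈ x ∷ x ∷ w → AbabFree (z ∷ x ∷ x ∷ w) → z ∈ alive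
  complete′ (here refl) free = complete (here refl) (drop-second _ x (x ∷ w) free)
  complete′ (there z∈w) free = complete z∈w (drop-second _ x (x ∷ w) free)

-- Prepending an old symbol x in front of y kills y (y x y x would follow) and
-- re-uses x, so the alive list shrinks by at least one.
revisit-step : ∀ {S x y w} → x ≢ y → x ∈ w → AbabFree (x ∷ y ∷ w) → Alive S (y ∷ w) → Alive S (x ∷ y ∷ w)
revisit-step {S} {x} {y} {w} x≢y x∈w free A = record
  { alive = x ∷ survivors ; budget = budget′ ; complete = complete′ }
  where
  open Alive A
  survivors : List ℕ
  survivors = remove y (remove x alive)
  x-alive : x ∈ alive
  x-alive = complete (there x∈w) free
  y-alive : y ∈ alive
  y-alive = complete (here refl) (dup-head (abab-free-⊆ (x ∷ʳ ⊆-refl) free))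
  shrink : suc (suc (length survivors)) ≤ length alive
  shrink = ≤-trans (s≤s (remove-shrinks (remove x alive) (remove-keeps alive y-alive (x≢y ∘ sym))))
                   (remove-shrinks alive x-alive)
  p p′ : ℕ
  p = present S (y ∷ w)
  p′ = present S (x ∷ y ∷ w)
  budget′ : length (x ∷ y ∷ w) + length (x ∷ survivors) ≤ p′ + p′ + repeats (x ∷ y ∷ w)
  budget′ = begin
    suc (length (y ∷ w)) + suc (length survivors)   ≡⟨ +-suc (length (y ∷ w)) (suc (length survivors)) ⟨
    length (y ∷ w) + suc (suc (length survivors))   ≤⟨ +-monoʳ-≤ (length (y ∷ w)) shrink ⟩
    length (y ∷ w) + length alive                   ≤⟨ budget ⟩
    p + p + repeats (y ∷ w)                         ≤⟨ +-mono-≤ (+-mono-≤ mono mono) (repeats-cons x (y ∷ w)) ⟩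
    p′ + p′ + repeats (x ∷ y ∷ w)                   ∎
    where
    open ≤-Reasoning
    mono : p ≤ p′
    mono = present-mono S x (y ∷ w)
  complete′ : ∀ {z} → z ∈ x ∷ y ∷ w → AbabFree (z ∷ x ∷ y ∷ w) → z ∈ x ∷ survivors
  complete′ (here refl) _ = here refl
  complete′ {z} (there z∈yw) free-z with z ≟ x | z ≟ y
  ... | yes refl | _        = here refl
  ... | no  _    | yes refl = ⊥-elim (free-z y x (x≢y ∘ sym) (refl ∷ refl ∷ refl ∷ from∈ x∈w))
  ... | no  z≢x  | no  z≢y  =
    there (remove-keeps (remove x alive)
            (remove-keeps alive (complete z∈yw (drop-second z x (y ∷ w) free-z)) z≢x) z≢y)

alive-stack : ∀ S w → AbabFree w → (∀ {z} → z ∈ w → z ∈ S) → Alive S w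
alive-stack S [] _ _ = record { alive = [] ; budget = z≤n ; complete = λ () }
alive-stack S (x ∷ w) free inS
  with x ∈? w | alive-stack S w (abab-free-⊆ (x ∷ʳ ⊆-refl) free) (inS ∘ there)
... | no x∉w | A = fresh-step x∉w (inS (here refl)) A
alive-stack S (x ∷ y ∷ w) free inS | yes x∈yw | A with x ≟ y | x∈yw
... | yes refl | _           = repeat-step A
... | no  x≢y  | here x≡y    = ⊥-elim (x≢y x≡y)
... | no  x≢y  | there x∈w   = revisit-step x≢y x∈w free A

abab-free-length : ∀ S w → AbabFree w → (∀ {z} → z ∈ w → z ∈ S) →
  length w ≤ present S w + present S w + repeats w
abab-free-length S w free inS = ≤-trans (m≤m+n (length w) _) budget
  where open Alive (alive-stack S w free inS)

record Good (n k : ℕ) (w S : List ℕ) : Set where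
  field
    unique           : Unique S
    frequent         : ∀ {a} → a ∈ S → k ≤ occ a w
    alternation-free : ∀ {a b} → a ∈ S → b ∈ S → a ≢ b → ¬ (alt a b n ⊆ w)

concat-filter : ∀ {P : ℕ → Set} (P? : Decidable P) bs → concat (map (filter P?) bs) ≡ filter P? (concat bs)
concat-filter P? []       = refl
concat-filter P? (b ∷ bs) = trans (cong (filter P? b ++_) (concat-filter P? bs)) (sym (filter-++ P? b (concat bs)))

triple≤double⇒ : ∀ {n m} → 3 * n ≤ n + n + m → n ≤ m
triple≤double⇒ {n} {m} h = +-cancelˡ-≤ (n + n) n m (subst (_≤ n + n + m) (triple n) h)
  where
  open +-*-Solver
  triple : ∀ n → 3 * n ≡ n + n + n
  triple = solve 1 (λ n → con 3 :* n := n :+ n :+ n) refl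

good-bound-base : ∀ bs S → All Unique bs → Good 4 3 (flatten bs) S → length S ≤ length bs
good-bound-base bs S blocks G = triple≤double⇒ (begin
  3 * length S                               ≤⟨ occurrence-mass 3 S w′ unique freq′ ⟩
  length w′                                  ≤⟨ abab-free-length S w′ free inS ⟩
  present S w′ + present S w′ + repeats w′   ≤⟨ +-mono-≤ (+-mono-≤ few few) rep ⟩
  length S + length S + length bs            ∎)
  where
  open ≤-Reasoning
  open Good G
  w w′ : List ℕ
  bs′ : List Block
  w = concat bs
  bs′ = map (filter (_∈? S)) bs
  w′ = concat bs′
  w′≡ : w′ ≡ filter (_∈? S) w
  w′≡ = concat-filter (_∈? S) bs
  inS : ∀ {z} → z ∈ w′ → z ∈ S
  inS z∈w′ = proj₂ (∈-filter⁻ (_∈? S) {xs = w} (subst (_ ∈_) w′≡ z∈w′))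
  freq′ : ∀ {a} → a ∈ S → 3 ≤ occ a w′
  freq′ {a} a∈S =
    subst (3 ≤_) (sym (trans (cong (occ a) w′≡) (occ-filter (_∈? S) w a∈S))) (frequent a∈S)
  free : AbabFree w′
  free a b a≢b p = alternation-free (inS (to∈ p)) (inS (to∈ (∷ˡ⁻ p))) a≢b
    (⊆-trans p (subst (_⊆ w) (sym w′≡) (filter-⊆ (_∈? S) w)))
  few : present S w′ ≤ length S
  few = length-filter (_∈? w′) S
  rep : repeats w′ ≤ length bs
  rep = subst (repeats w′ ≤_) (length-map _ bs)
              (repeats-concat bs′ (map⁺ (All.map (filter⁺ (_∈? S)) blocks)))

good-left : ∀ {n k u v S T} → Good n k (u ++ v) S → Unique T →
  (∀ {a} → a ∈ T → a ∈ S × occ a v ≡ 0) → Good n k u T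
good-left {n} {k} {u} {v} G uniqT sub = record
  { unique           = uniqT
  ; frequent         = λ {a} a∈T → subst (k ≤_)
      (trans (occ-++ a u v) (trans (cong (occ a u +_) (proj₂ (sub a∈T))) (+-identityʳ _)))
      (frequent (proj₁ (sub a∈T)))
  ; alternation-free = λ a∈T b∈T a≢b p →
      alternation-free (proj₁ (sub a∈T)) (proj₁ (sub b∈T)) a≢b (++⁺ʳ v p)
  }
  where open Good G

good-right : ∀ {n k u v S T} → Good n k (u ++ v) S → Unique T →
  (∀ {a} → a ∈ T → a ∈ S × occ a u ≡ 0) → Good n k v T
good-right {n} {k} {u} {v} G uniqT sub = record
  { unique           = uniqT
  ; frequent         = λ {a} a∈T → subst (k ≤_)
      (trans (occ-++ a u v) (cong (_+ occ a v) (proj₂ (sub a∈T))))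
      (frequent (proj₁ (sub a∈T)))
  ; alternation-free = λ a∈T b∈T a≢b p →
      alternation-free (proj₁ (sub a∈T)) (proj₁ (sub b∈T)) a≢b (++⁺ˡ u p)
  }
  where open Good G

-- Symbols also present in v: an alternation of length n in u ends with a or b,
-- which can be matched once more in v.
good-left-ext : ∀ {n k k′ u v S T} → Good (suc n) k (u ++ v) S → Unique T →
  (∀ {a} → a ∈ T → a ∈ S × a ∈ v × k′ ≤ occ a u) → Good n k′ u T
good-left-ext {n} {u = u} {v} {T = T} G uniqT sub = record
  { unique           = uniqT
  ; frequent         = λ a∈T → proj₂ (proj₂ (sub a∈T))
  ; alternation-free = λ {a} {b} a∈T b∈T a≢b p →
      alternation-free (proj₁ (sub a∈T)) (proj₁ (sub b∈T)) a≢b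
        (subst (_⊆ u ++ v) (sym (alt-snoc a b n))
          (++⁺ p (from∈ (alt-last-elim {_∈ v} a b n (in-v a∈T) (in-v b∈T)))))
  }
  where
  open Good G
  in-v : ∀ {a} → a ∈ T → a ∈ v
  in-v a∈T = proj₁ (proj₂ (sub a∈T))

-- Symbols also present in u: an alternation a b … in v is preceded by b in u.
good-right-ext : ∀ {n k k′ u v S T} → Good (suc n) k (u ++ v) S → Unique T →
  (∀ {a} → a ∈ T → a ∈ S × a ∈ u × k′ ≤ occ a v) → Good n k′ v T
good-right-ext G uniqT sub = record
  { unique           = uniqT
  ; frequent         = λ a∈T → proj₂ (proj₂ (sub a∈T))
  ; alternation-free = λ a∈T b∈T a≢b p →
      alternation-free (proj₁ (sub b∈T)) (proj₁ (sub a∈T)) (a≢b ∘ sym)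
        (++⁺ (from∈ (proj₁ (proj₂ (sub b∈T)))) p)
  }
  where open Good G

heavy-half : ∀ x p q → 2 * x + 1 ≤ p + q → ¬ (x + 1 ≤ p) → x + 1 ≤ q
heavy-half x p q total light = +-cancelˡ-≤ x (x + 1) q (begin
  x + (x + 1)    ≡⟨ split x ⟩
  2 * x + 1      ≤⟨ total ⟩
  p + q          ≤⟨ +-monoˡ-≤ q p≤x ⟩
  x + q          ∎)
  where
  open ≤-Reasoning
  open +-*-Solver
  split : ∀ x → x + (x + 1) ≡ 2 * x + 1
  split = solve 1 (λ x → x :+ (x :+ con 1) := con 2 :* x :+ con 1) refl
  p≤x : p ≤ x
  p≤x = m<1+n⇒m≤n (subst (p <_) (+-comm x 1) (≰⇒> light))

-- The four classes of symbols of S when the sequence is cut into u ++ v: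
-- S₁ only in u; S₂ in v and heavy in u; S₃ only in v; S₄ in both, light in u.
module Halving {n x : ℕ} {u v S : List ℕ} (G : Good (suc n) (2 * x + 1) (u ++ v) S) where
  open Good G

  absent-v? : Decidable (λ a → occ a v ≡ 0)
  absent-v? a = occ a v ≟ 0
  heavy-u? : Decidable (λ a → x + 1 ≤ occ a u)
  heavy-u? a = x + 1 ≤? occ a u
  absent-u? : Decidable (λ a → occ a u ≡ 0)
  absent-u? a = occ a u ≟ 0

  S₁ T₁ S₂ T₂ S₃ S₄ : List ℕ
  S₁ = filter absent-v? S
  T₁ = filter (¬? ∘ absent-v?) S
  S₂ = filter heavy-u? T₁
  T₂ = filter (¬? ∘ heavy-u?) T₁
  S₃ = filter absent-u? T₂
  S₄ = filter (¬? ∘ absent-u?) T₂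

  partition : length S ≡ length S₁ + (length S₂ + (length S₃ + length S₄))
  partition = begin
    length S                                         ≡⟨ length-split absent-v? S ⟩
    length S₁ + length T₁                            ≡⟨ cong (length S₁ +_) (length-split heavy-u? T₁) ⟩
    length S₁ + (length S₂ + length T₂)              ≡⟨ cong (λ q → length S₁ + (length S₂ + q)) (length-split absent-u? T₂) ⟩
    length S₁ + (length S₂ + (length S₃ + length S₄)) ∎
    where open ≡-Reasoning

  unique₁ : Unique T₁
  unique₁ = filter⁺ _ unique
  unique₂ : Unique T₂
  unique₂ = filter⁺ _ unique₁

  ∈T₁ : ∀ {a} → a ∈ T₁ → a ∈ S × a ∈ v
  ∈T₁ a∈T₁ with ∈-filter⁻ (¬? ∘ absent-v?) {xs = S} a∈T₁
  ... | a∈S , in-v = a∈S , occ-pos⇒∈ v (n≢0⇒n>0 in-v)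

  ∈T₂ : ∀ {a} → a ∈ T₂ → a ∈ S × ¬ (x + 1 ≤ occ a u)
  ∈T₂ a∈T₂ with ∈-filter⁻ (¬? ∘ heavy-u?) {xs = T₁} a∈T₂
  ... | a∈T₁ , light = proj₁ (∈T₁ a∈T₁) , light

  good₁ : Good (suc n) (2 * x + 1) u S₁
  good₁ = good-left G (filter⁺ _ unique) (∈-filter⁻ absent-v? {xs = S})

  good₂ : Good n (x + 1) u S₂
  good₂ = good-left-ext G (filter⁺ _ unique₁) classify
    where
    classify : ∀ {a} → a ∈ S₂ → a ∈ S × a ∈ v × x + 1 ≤ occ a u
    classify a∈S₂ with ∈-filter⁻ heavy-u? {xs = T₁} a∈S₂
    ... | a∈T₁ , heavy = proj₁ (∈T₁ a∈T₁) , proj₂ (∈T₁ a∈T₁) , heavy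

  good₃ : Good (suc n) (2 * x + 1) v S₃
  good₃ = good-right G (filter⁺ _ unique₂) classify
    where
    classify : ∀ {a} → a ∈ S₃ → a ∈ S × occ a u ≡ 0
    classify a∈S₃ with ∈-filter⁻ absent-u? {xs = T₂} a∈S₃
    ... | a∈T₂ , absent = proj₁ (∈T₂ a∈T₂) , absent

  good₄ : Good n (x + 1) v S₄
  good₄ = good-right-ext G (filter⁺ _ unique₂) classify
    where
    classify : ∀ {a} → a ∈ S₄ → a ∈ S × a ∈ u × x + 1 ≤ occ a v
    classify {a} a∈S₄ with ∈-filter⁻ (¬? ∘ absent-u?) {xs = T₂} a∈S₄
    ... | a∈T₂ , in-u = a∈S , occ-pos⇒∈ u (n≢0⇒n>0 in-u) ,
        heavy-half x (occ a u) (occ a v) (subst (2 * x + 1 ≤_) (occ-++ a u v) (frequent a∈S)) light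
      where
      a∈S : a ∈ S
      a∈S = proj₁ (∈T₂ a∈T₂)
      light : ¬ (x + 1 ≤ occ a u)
      light = proj₂ (∈T₂ a∈T₂)

halving : ∀ {n x u v S B B′} → Good (suc n) (2 * x + 1) (u ++ v) S →
  (∀ {T} → Good (suc n) (2 * x + 1) u T → length T ≤ B) →
  (∀ {T} → Good n (x + 1) u T → length T ≤ B′) →
  (∀ {T} → Good (suc n) (2 * x + 1) v T → length T ≤ B) →
  (∀ {T} → Good n (x + 1) v T → length T ≤ B′) →
  length S ≤ B + (B′ + (B + B′))
halving {n} {x} {u} {v} G bound-u bound-u′ bound-v bound-v′ = subst (_≤ _) (sym partition)
  (+-mono-≤ (bound-u good₁) (+-mono-≤ (bound-u′ good₂) (+-mono-≤ (bound-v good₃) (bound-v′ good₄))))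
  where open Halving {n} {x} {u} {v} G

halves-fit : ∀ h (bs : List Block) → length bs ≤ 2 * h →
  length (take h bs) ≤ h × length (drop h bs) ≤ h
halves-fit h bs nb =
  subst (_≤ h) (sym (length-take h bs)) (m⊓n≤m h (length bs)) ,
  subst (_≤ h) (sym (length-drop h bs))
        (m≤n+o⇒m∸n≤o (length bs) h (subst (length bs ≤_) (cong (h +_) (+-identityʳ h)) nb))

bound-recurrence : ∀ t j →
  2 ^ j * j ^ suc t + (2 ^ j * j ^ t + (2 ^ j * j ^ suc t + 2 ^ j * j ^ t)) ≤ 2 ^ suc j * suc j ^ suc t
bound-recurrence t j = begin
  P * (j * Q) + (P * Q + (P * (j * Q) + P * Q))  ≡⟨ collect P j Q ⟩
  (2 * P) * (suc j * Q)                           ≤⟨ *-monoʳ-≤ (2 * P) (*-monoʳ-≤ (suc j) (^-monoˡ-≤ t (n≤1+n j))) ⟩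
  (2 * P) * (suc j * suc j ^ t)                   ∎
  where
  open ≤-Reasoning
  open +-*-Solver
  P Q : ℕ
  P = 2 ^ j
  Q = j ^ t
  collect : ∀ P j Q → P * (j * Q) + (P * Q + (P * (j * Q) + P * Q)) ≡ (2 * P) * (suc j * Q)
  collect = solve 3 (λ P j Q → P :* (j :* Q) :+ (P :* Q :+ (P :* (j :* Q) :+ P :* Q))
                               := (con 2 :* P) :* ((con 1 :+ j) :* Q)) refl

good-bound : ∀ t j bs → All Unique bs → length bs ≤ 2 ^ j → ∀ {S} →
  Good (suc (suc t) + 2) (2 ^ suc t + 1) (flatten bs) S → length S ≤ 2 ^ j * j ^ t
good-bound zero j bs blocks nb {S} G =
  ≤-trans (good-bound-base bs S blocks G) (subst (length bs ≤_) (sym (*-identityʳ (2 ^ j))) nb)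
good-bound (suc t) zero bs blocks nb {[]}    G = z≤n
good-bound (suc t) zero bs blocks nb {a ∷ S} G =
  -- a single block cannot hold 2^(t+2) + 1 ≥ 2 copies of a
  ⊥-elim (1+n≰n (≤-trans k≥2 (≤-trans (frequent (here refl)) (≤-trans (occ-concat a bs blocks) nb))))
  where
  open Good G
  k≥2 : 2 ≤ 2 ^ suc (suc t) + 1
  k≥2 = subst (2 ≤_) (+-comm 1 (2 ^ suc (suc t))) (s≤s (m^n>0 2 (suc (suc t))))
good-bound (suc t) (suc j) bs blocks nb G = ≤-trans
  (halving (subst (λ w → Good _ _ w _) split G)
     (good-bound (suc t) j L (take⁺ h blocks) fitL) (good-bound t j L (take⁺ h blocks) fitL)
     (good-bound (suc t) j R (drop⁺ h blocks) fitR) (good-bound t j R (drop⁺ h blocks) fitR))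
  (bound-recurrence t j)
  where
  h : ℕ
  h = 2 ^ j
  L R : List Block
  L = take h bs
  R = drop h bs
  split : flatten bs ≡ flatten L ++ flatten R
  split = sym (trans (concat-++ L R) (cong concat (take++drop≡id h bs)))
  fitL : length L ≤ h
  fitL = proj₁ (halves-fit h bs nb)
  fitR : length R ≤ h
  fitR = proj₂ (halves-fit h bs nb)

1≤⌊log₂⌋ : ∀ {m} → 2 ≤ m → 1 ≤ ⌊log₂ m ⌋
1≤⌊log₂⌋ {m} m≥2 = subst (_≤ ⌊log₂ m ⌋) (⌊log₂[2^n]⌋≡n 1) (⌊log₂⌋-mono-≤ m≥2)

2^⌊log₂⌋≤ : ∀ m → 1 ≤ m → 2 ^ ⌊log₂ m ⌋ ≤ m
2^⌊log₂⌋≤ = <-rec (λ m → 1 ≤ m → 2 ^ ⌊log₂ m ⌋ ≤ m) step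
  where
  step : ∀ m → (∀ {k} → k < m → 1 ≤ k → 2 ^ ⌊log₂ k ⌋ ≤ k) → 1 ≤ m → 2 ^ ⌊log₂ m ⌋ ≤ m
  step zero          _  ()
  step (suc zero)    _  _ = ≤-refl
  step (suc (suc m)) ih _ = begin
    2 ^ ⌊log₂ n ⌋             ≡⟨ cong (2 ^_) log-halve ⟩
    2 * 2 ^ ⌊log₂ ⌊ n /2⌋ ⌋   ≤⟨ *-monoʳ-≤ 2 (ih (⌊n/2⌋<n (suc m)) (s≤s z≤n)) ⟩
    2 * ⌊ n /2⌋               ≤⟨ twice-half ⟩
    n                         ∎
    where
    open ≤-Reasoning
    n : ℕ
    n = suc (suc m)
    log-halve : ⌊log₂ n ⌋ ≡ suc ⌊log₂ ⌊ n /2⌋ ⌋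
    log-halve = trans (sym (m+[n∸m]≡n (1≤⌊log₂⌋ {n} (s≤s (s≤s z≤n)))))
                      (cong suc (sym (⌊log₂⌊n/2⌋⌋≡⌊log₂n⌋∸1 n)))
    twice-half : 2 * ⌊ n /2⌋ ≤ n
    twice-half = subst₂ _≤_ (cong (⌊ n /2⌋ +_) (sym (+-identityʳ ⌊ n /2⌋))) (⌊n/2⌋+⌈n/2⌉≡n n)
                   (+-monoʳ-≤ ⌊ n /2⌋ (⌊n/2⌋≤⌈n/2⌉ n))

≤2^[1+⌊log₂⌋] : ∀ m → m ≤ 2 ^ suc ⌊log₂ m ⌋
≤2^[1+⌊log₂⌋] m = ≮⇒≥ λ lt → n≮n ⌊log₂ m ⌋
  (subst (_≤ ⌊log₂ m ⌋) (⌊log₂[2^n]⌋≡n (suc ⌊log₂ m ⌋)) (⌊log₂⌋-mono-≤ (<⇒≤ lt)))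

[m*n]^o≡m^o*n^o : ∀ m n o → (m * n) ^ o ≡ m ^ o * n ^ o
[m*n]^o≡m^o*n^o m n zero    = refl
[m*n]^o≡m^o*n^o m n (suc o) = trans (cong ((m * n) *_) ([m*n]^o≡m^o*n^o m n o)) (interchange m n (m ^ o) (n ^ o))
  where
  open +-*-Solver
  interchange : ∀ a b c d → a * b * (c * d) ≡ a * c * (b * d)
  interchange = solve 4 (λ a b c d → a :* b :* (c :* d) := a :* c :* (b :* d)) refl

log-bound : ∀ t L m → 1 ≤ L → 2 ^ L ≤ m → 2 ^ suc L * suc L ^ t ≤ 2 * 2 ^ t * m * L ^ t
log-bound t L m L≥1 2^L≤m = begin
  2 * 2 ^ L * suc L ^ t    ≤⟨ *-mono-≤ (*-monoʳ-≤ 2 2^L≤m) (^-monoˡ-≤ t 1+L≤2L) ⟩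
  2 * m * (2 * L) ^ t      ≡⟨ cong ((2 * m) *_) ([m*n]^o≡m^o*n^o 2 L t) ⟩
  2 * m * (2 ^ t * L ^ t)  ≡⟨ reorder m (2 ^ t) (L ^ t) ⟩
  2 * 2 ^ t * m * L ^ t    ∎
  where
  open ≤-Reasoning
  open +-*-Solver
  1+L≤2L : suc L ≤ 2 * L
  1+L≤2L = subst₂ _≤_ (+-comm L 1) (cong (L +_) (sym (+-identityʳ L))) (+-monoʳ-≤ L L≥1)
  reorder : ∀ m a b → 2 * m * (a * b) ≡ 2 * a * m * b
  reorder = solve 3 (λ m a b → con 2 :* m :* (a :* b) := con 2 :* a :* m :* b) refl

ads-good : ∀ {s k m bs} → IsADS s k m bs →
  Good (s + 2) k (flatten bs) (deduplicate _≟_ (flatten bs))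
ads-good {bs = bs} ads = record
  { unique           = deduplicate-! (flatten bs)
  ; frequent         = λ {a} a∈ → frequent a (∈-deduplicate⁻ _≟_ (flatten bs) a∈)
  ; alternation-free = λ {a} {b} _ _ a≢b → noAlt a b a≢b
  }
  where open IsADS ads

corollary4p6 : ∀ (s : ℕ) → 2 ≤ s →
    Σ ℕ λ C → Σ ℕ λ m₀ → ∀ (m : ℕ) → m₀ ≤ m →
      ∀ (bs : List Block) → IsADS s (2 ^ (s ∸ 1) + 1) m bs →
        distinct (flatten bs) ≤ C * m * ⌊log₂ m ⌋ ^ (s ∸ 2)
corollary4p6 (suc zero)    (s≤s ())
corollary4p6 (suc (suc t)) _ = 2 * 2 ^ t , 2 , λ m m≥2 bs ads →
  let open IsADS ads
      L : ℕ
      L = ⌊log₂ m ⌋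
      few-blocks : length bs ≤ 2 ^ suc L
      few-blocks = subst (_≤ 2 ^ suc L) (sym nblocks) (≤2^[1+⌊log₂⌋] m)
  in ≤-trans (good-bound t (suc L) bs blocksDistinct few-blocks (ads-good ads))
             (log-bound t L m (1≤⌊log₂⌋ m≥2) (2^⌊log₂⌋≤ m (≤-trans (s≤s z≤n) m≥2)))
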